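{- Let $S$ be a finite subset of $\mathbb{N}=\{1,2,3,\dots\}$. The following are equivalent: (1) there exist finite digraphs $G$, $H$ such that $S=FF(G,H)$; (2) there is a finite set $T\subset\mathbb{N}$ such that $S=\{s\in\mathbb{N}: \exists t\in T,\ s\mid t\}$.
   Context: Digraphs are finite multidigraphs; loops and parallel edges are allowed. For an abelian group $M$, a map $\varphi:E(G)\to M$ is an $M$-flow if at every vertex $v$ the sum of $\varphi$ over edges leaving $v$ equals the sum of $\varphi$ over edges entering $v$. A mapping $f:E(G)\to E(H)$ is $M$-flow-continuous if for every $M$-flow $\varphi$ on $H$ the composition $\varphi\circ f$ is an $M$-flow on $G$. We set $FF(G,H)=\{n\ge 1: \text{there is a } \mathbb{Z}_n\text{ -flow-continuous mapping } f:E(G)\to E(H)\}$. -}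

module Defs where

open import Data.Nat using (ℕ; suc; _%_; _≤_)
open import Data.Nat.Properties using ()
open import Data.Fin using (Fin; toℕ; _≟_)
open import Data.List using (List; map; allFin)
open import Data.Nat.ListAction using (sum)
open import Data.List.Membership.Propositional using (_∈_)
open import Data.Product using (Σ; _×_; ∃-syntax)
open import Relation.Nullary using (does)
open import Data.Bool using (if_then_else_)
open import Relation.Binary.PropositionalEquality using (_≡_)

record Digraph : Set where
  field
    V   : ℕ
    E   : ℕ
    src : Fin E → Fin V
    tgt : Fin E → Fin V
open Digraph public

-- Z_n with n = suc k, elements represented by Fin (suc k).
Zmod : ℕ → Set
Zmod k = Fin (suc k)

outSum : (G : Digraph) {k : ℕ} → (Fin (E G) → Zmod k) → Fin (V G) → ℕ
outSum G φ v = sum (map (λ e → if does (src G e ≟ v) then toℕ (φ e) else 0) (allFin (E G)))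

inSum : (G : Digraph) {k : ℕ} → (Fin (E G) → Zmod k) → Fin (V G) → ℕ
inSum G φ v = sum (map (λ e → if does (tgt G e ≟ v) then toℕ (φ e) else 0) (allFin (E G)))

IsFlow : (G : Digraph) (k : ℕ) → (Fin (E G) → Zmod k) → Set
IsFlow G k φ = ∀ v → outSum G φ v % suc k ≡ inSum G φ v % suc k

FlowContinuous : (G H : Digraph) (k : ℕ) → (Fin (E G) → Fin (E H)) → Set
FlowContinuous G H k f = ∀ (φ : Fin (E H) → Zmod k) → IsFlow H k φ → IsFlow G k (λ e → φ (f e))

data InFF (G H : Digraph) : ℕ → Set where
  inFF : ∀ k (f : Fin (E G) → Fin (E H)) → FlowContinuous G H k f → InFF G H (suc k)

-- (1) ⇒ (2): FF(G,H) is closed under divisors, because multiplication by n/d embeds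
-- ℤ_d into ℤ_n and a weighting is a ℤ_d-flow iff its image is a ℤ_n-flow; take T = S.
--
-- (2) ⇒ (1): put L = ∏ T and m = (3L)! + 1. Let G be the disjoint union of two bundles
-- of m and m + L parallel edges, and H the disjoint union over t ∈ T of dipoles with one
-- back edge and m − t + 1 forward edges. If n ∣ t, each bundle folds onto the dipole of t
-- (every forward edge once, the back edge for the remaining edges), and this is
-- ℤ_n-flow-continuous since n ∣ t ∣ L. Conversely, pulling back the digons of H made of
-- the back edge and one forward edge shows that the preimage counts of a bundle of size M
-- force n ∣ M or n ∣ M − (m − t) for some t; as m − t > (m + L)/2 at most one dipole
-- contributes, and since m ≡ 1 modulo every number up to 3L only n ∣ t survives.
module Submission where

open import Defs
open import Data.Nat using (ℕ; _≤_)
open import Data.Nat.Divisibility using (_∣_)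
open import Data.List using (List)
open import Data.List.Membership.Propositional using (_∈_)
open import Data.List.Relation.Unary.All using (All)
open import Data.Product using (Σ; _×_; ∃-syntax)
open import Function.Bundles using (_⇔_)

open import Data.Nat using (zero; suc; pred; _!; NonZero; ≢-nonZero; >-nonZero; >-nonZero⁻¹;
  _+_; _*_; _∸_; _<_; _%_; z≤n; s≤s)
open import Data.Nat.Properties hiding (_≟_)
open import Data.Nat.DivMod using (m%n*o≡m*o%[n*o]; %-distribˡ-+)
open import Data.Nat.Divisibility using (_∣?_; divides; _∣0; 1∣_; ∣-refl; ∣-trans; ∣m∣n⇒∣m+n;
  ∣m+n∣m⇒∣n; ∣m⇒∣m*n; m∣m*n; m%n≡0⇒n∣m; n∣m⇒m%n≡0; m≤n⇒m!∣n!; 0∣⇒≡0; ∣1⇒≡1; ∣⇒≤)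
open import Data.Nat.Tactic.RingSolver using (solve-∀)
open import Algebra.Properties.Semiring.Sum +-*-semiring
  using (sum-syntax; sum-cong-≗; sum-replicate-zero; ∑-distrib-+; ∑-comm; *-distribʳ-sum)
import Data.Nat.ListAction as ListAction
open import Data.Nat.ListAction using (product)
open import Data.Nat.ListAction.Properties using (∈⇒∣product; product≢0)
open import Data.Fin using (Fin; zero; suc; toℕ; fromℕ<; _↑ˡ_; _↑ʳ_; _≟_; splitAt; join)
open import Data.Fin.Properties using (toℕ-fromℕ<; toℕ<n; splitAt-↑ˡ; splitAt-↑ʳ; join-splitAt;
  ↑ˡ-injective; ↑ʳ-injective)
open import Data.Vec.Functional using (_++_)
open import Data.Vec.Functional.Properties using (lookup-++ˡ; lookup-++ʳ)
open import Data.List using ([]; _∷_; map; allFin; tabulate)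
open import Data.List.Properties using (map-tabulate)
open import Data.List.Relation.Unary.Any using (here; there)
open import Data.List.Membership.Propositional.Properties using (∈-map⁺; ∈-map⁻)
import Data.List.Relation.Unary.All as All
open import Data.Bool using (true; false; if_then_else_)
import Data.Sum as Sum
open import Data.Sum using (_⊎_; inj₁; inj₂)
open import Data.Product using (_,_; proj₁; proj₂)
open import Relation.Nullary using (does; yes; no; contradiction)
open import Relation.Binary.PropositionalEquality
open import Function using (_∘_; mk⇔; Equivalence; Injective)
open import Function.Properties.Equivalence using () renaming (trans to ⇔-trans; sym to ⇔-sym)

δ : ∀ {n} → Fin n → Fin n → ℕ
δ i j = if does (i ≟ j) then 1 else 0

δ-refl : ∀ {n} (i : Fin n) → δ i i ≡ 1
δ-refl i with i ≟ i
... | yes _ = refl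
... | no i≢i = contradiction refl i≢i

δ-≢ : ∀ {n} {i j : Fin n} → i ≢ j → δ i j ≡ 0
δ-≢ {i = i} {j} i≢j with i ≟ j
... | yes i≡j = contradiction i≡j i≢j
... | no _ = refl

δ-sym : ∀ {n} (i j : Fin n) → δ i j ≡ δ j i
δ-sym i j with i ≟ j
... | yes refl = sym (δ-refl i)
... | no i≢j = sym (δ-≢ (i≢j ∘ sym))

δ-suc : ∀ {n} (i j : Fin n) → δ (suc i) (suc j) ≡ δ i j
δ-suc i j with i ≟ j
... | yes _ = refl
... | no _ = refl

δ-injective : ∀ {m n} {f : Fin m → Fin n} → Injective _≡_ _≡_ f → ∀ i j → δ (f i) (f j) ≡ δ i j
δ-injective {f = f} f-inj i j with i ≟ j
... | yes refl = δ-refl (f i)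
... | no i≢j = δ-≢ (i≢j ∘ f-inj)

δ+δ≤1 : ∀ {n} {i j : Fin n} → i ≢ j → ∀ e → δ i e + δ j e ≤ 1
δ+δ≤1 {i = i} {j} i≢j e with i ≟ e | j ≟ e
... | yes refl | yes refl = contradiction refl i≢j
... | yes _ | no _ = s≤s z≤n
... | no _ | yes _ = s≤s z≤n
... | no _ | no _ = z≤n

sum-map-allFin : ∀ n (g : Fin n → ℕ) → ListAction.sum (map g (allFin n)) ≡ ∑[ i < n ] g i
sum-map-allFin n g = trans (cong ListAction.sum (map-tabulate {n = n} (λ i → i) g)) (sum-tabulate n g)
  where
  sum-tabulate : ∀ n (g : Fin n → ℕ) → ListAction.sum (tabulate g) ≡ ∑[ i < n ] g i
  sum-tabulate zero g = refl
  sum-tabulate (suc n) g = cong (g zero +_) (sum-tabulate n (g ∘ suc))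

∑-↑ : ∀ m n (f : Fin (m + n) → ℕ) → ∑[ i < m + n ] f i ≡ ∑[ i < m ] f (i ↑ˡ n) + ∑[ j < n ] f (m ↑ʳ j)
∑-↑ zero n f = refl
∑-↑ (suc m) n f = trans (cong (f zero +_) (∑-↑ m n (f ∘ suc))) (sym (+-assoc (f zero) _ _))

∑-const : ∀ n c → ∑[ i < n ] c ≡ n * c
∑-const zero c = refl
∑-const (suc n) c = cong (c +_) (∑-const n c)

∑-mono-≤ : ∀ n {f g : Fin n → ℕ} → (∀ i → f i ≤ g i) → ∑[ i < n ] f i ≤ ∑[ i < n ] g i
∑-mono-≤ zero f≤g = z≤n
∑-mono-≤ (suc n) f≤g = +-mono-≤ (f≤g zero) (∑-mono-≤ n (f≤g ∘ suc))

∑-∣ : ∀ {d} n (f : Fin n → ℕ) → (∀ i → d ∣ f i) → d ∣ ∑[ i < n ] f i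
∑-∣ zero f d∣f = _ ∣0
∑-∣ (suc n) f d∣f = ∣m∣n⇒∣m+n (d∣f zero) (∑-∣ n (f ∘ suc) (d∣f ∘ suc))

∑-δ : ∀ {n} (i : Fin n) (x : Fin n → ℕ) → ∑[ j < n ] (δ i j * x j) ≡ x i
∑-δ {suc n} zero x = trans (cong₂ _+_ (*-identityˡ (x zero)) (sum-replicate-zero n)) (+-identityʳ (x zero))
∑-δ {suc n} (suc i) x = trans (sum-cong-≗ λ j → cong (_* x (suc j)) (δ-suc i j)) (∑-δ i (x ∘ suc))

preimages : ∀ {m n} → (Fin m → Fin n) → Fin n → ℕ
preimages {m} f j = ∑[ i < m ] δ (f i) j

∑-preimages : ∀ {m n} (f : Fin m → Fin n) → ∑[ j < n ] preimages f j ≡ m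
∑-preimages {m} {n} f = begin
  ∑[ j < n ] ∑[ i < m ] δ (f i) j   ≡⟨ ∑-comm (λ j i → δ (f i) j) ⟩
  ∑[ i < m ] ∑[ j < n ] δ (f i) j   ≡⟨ sum-cong-≗ (λ i → trans (sum-cong-≗ λ j → sym (*-identityʳ (δ (f i) j)))
                                                             (∑-δ (f i) (λ _ → 1))) ⟩
  ∑[ i < m ] 1                      ≡⟨ trans (∑-const m 1) (*-identityʳ m) ⟩
  m                                 ∎
  where open ≡-Reasoning

incidentSum : ∀ {E V} → (Fin E → Fin V) → Fin V → (Fin E → ℕ) → ℕ
incidentSum {E} s v x = ∑[ e < E ] (δ (s e) v * x e)

-- Flows with values in ℕ rather than in Zmod k, so that they can be added and scaled.
Balanced : (G : Digraph) (k : ℕ) → (Fin (E G) → ℕ) → Set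
Balanced G k x = ∀ v → incidentSum (src G) v x % suc k ≡ incidentSum (tgt G) v x % suc k

IsFlow⇔Balanced : ∀ G k (φ : Fin (E G) → Zmod k) → IsFlow G k φ ⇔ Balanced G k (toℕ ∘ φ)
IsFlow⇔Balanced G k φ = mk⇔
  (λ flow v → subst₂ (λ a b → a % suc k ≡ b % suc k) (sum≡incidentSum (src G) v) (sum≡incidentSum (tgt G) v) (flow v))
  (λ bal v → subst₂ (λ a b → a % suc k ≡ b % suc k) (sym (sum≡incidentSum (src G) v)) (sym (sum≡incidentSum (tgt G) v)) (bal v))
  where
  if-then-0 : ∀ b y → (if b then y else 0) ≡ (if b then 1 else 0) * y
  if-then-0 true y = sym (+-identityʳ y)
  if-then-0 false y = refl
  sum≡incidentSum : ∀ (s : Fin (E G) → Fin (V G)) v →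
    ListAction.sum (map (λ e → if does (s e ≟ v) then toℕ (φ e) else 0) (allFin (E G))) ≡ incidentSum s v (toℕ ∘ φ)
  sum≡incidentSum s v = trans (sum-map-allFin (E G) _) (sum-cong-≗ λ e → if-then-0 (does (s e ≟ v)) (toℕ (φ e)))

Balanced-cong : ∀ G k {x y : Fin (E G) → ℕ} → (∀ e → x e ≡ y e) → Balanced G k x → Balanced G k y
Balanced-cong G k x≗y bal v =
  subst₂ (λ a b → a % suc k ≡ b % suc k) (incidentSum-cong (src G)) (incidentSum-cong (tgt G)) (bal v)
  where
  incidentSum-cong : ∀ (s : Fin (E G) → Fin (V G)) → incidentSum s v _ ≡ incidentSum s v _
  incidentSum-cong s = sum-cong-≗ λ e → cong (δ (s e) v *_) (x≗y e)

incidentSum-*ʳ : ∀ {E V} (s : Fin E → Fin V) v (x : Fin E → ℕ) q →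
  incidentSum s v (λ e → x e * q) ≡ incidentSum s v x * q
incidentSum-*ʳ s v x q =
  trans (sum-cong-≗ λ e → sym (*-assoc (δ (s e) v) (x e) q)) (sym (*-distribʳ-sum q (λ e → δ (s e) v * x e)))

incidentSum-δ+δ : ∀ {E V} (s : Fin E → Fin V) v (e₁ e₂ : Fin E) →
  incidentSum s v (λ e → δ e₁ e + δ e₂ e) ≡ δ (s e₁) v + δ (s e₂) v
incidentSum-δ+δ s v e₁ e₂ = begin
  incidentSum s v (λ e → δ e₁ e + δ e₂ e)                   ≡⟨ sum-cong-≗ (λ e → *-distribˡ-+ (δ (s e) v) (δ e₁ e) (δ e₂ e)) ⟩
  ∑[ e < _ ] (δ (s e) v * δ e₁ e + δ (s e) v * δ e₂ e)       ≡⟨ ∑-distrib-+ (λ e → δ (s e) v * δ e₁ e) (λ e → δ (s e) v * δ e₂ e) ⟩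
  incidentSum s v (δ e₁) + incidentSum s v (δ e₂)           ≡⟨ cong₂ _+_ (picks e₁) (picks e₂) ⟩
  δ (s e₁) v + δ (s e₂) v                                   ∎
  where
  open ≡-Reasoning
  picks : ∀ e₀ → incidentSum s v (δ e₀) ≡ δ (s e₀) v
  picks e₀ = trans (sum-cong-≗ λ e → *-comm (δ (s e) v) (δ e₀ e)) (∑-δ e₀ (λ e → δ (s e) v))

_⊎ᶠ_ : ∀ {a b c d} → (Fin a → Fin c) → (Fin b → Fin d) → Fin (a + b) → Fin (c + d)
_⊎ᶠ_ {a} {c = c} {d} f g = join c d ∘ Sum.map f g ∘ splitAt a

⊎ᶠ-↑ˡ : ∀ {a b c d} (f : Fin a → Fin c) (g : Fin b → Fin d) i → (f ⊎ᶠ g) (i ↑ˡ b) ≡ f i ↑ˡ d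
⊎ᶠ-↑ˡ {a} {b} {c} {d} f g i = cong (join c d ∘ Sum.map f g) (splitAt-↑ˡ a i b)

⊎ᶠ-↑ʳ : ∀ {a b c d} (f : Fin a → Fin c) (g : Fin b → Fin d) j → (f ⊎ᶠ g) (a ↑ʳ j) ≡ c ↑ʳ g j
⊎ᶠ-↑ʳ {a} {b} {c} {d} f g j = cong (join c d ∘ Sum.map f g) (splitAt-↑ʳ a b j)

↑ˡ≢↑ʳ : ∀ {m n} (i : Fin m) (j : Fin n) → i ↑ˡ n ≢ m ↑ʳ j
↑ˡ≢↑ʳ {m} {n} i j eq with trans (sym (splitAt-↑ˡ m i n)) (trans (cong (splitAt m) eq) (splitAt-↑ʳ m n j))
... | ()

↑-elim : ∀ {m n} (P : Fin (m + n) → Set) → (∀ i → P (i ↑ˡ n)) → (∀ j → P (m ↑ʳ j)) → ∀ i → P i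
↑-elim {m} {n} P left right i = subst P (join-splitAt m n i) (Sum.[_,_] {C = P ∘ join m n} left right (splitAt m i))

incidentSum-↑ˡ : ∀ {a b c d} (f : Fin a → Fin c) (g : Fin b → Fin d) v (x : Fin (a + b) → ℕ) →
  incidentSum (f ⊎ᶠ g) (v ↑ˡ d) x ≡ incidentSum f v (x ∘ (_↑ˡ b))
incidentSum-↑ˡ {a} {b} {c} {d} f g v x =
  trans (∑-↑ a b _) (trans (cong₂ _+_ (sum-cong-≗ same) (trans (sum-cong-≗ disjoint) (sum-replicate-zero b))) (+-identityʳ _))
  where
  same : ∀ i → δ ((f ⊎ᶠ g) (i ↑ˡ b)) (v ↑ˡ d) * x (i ↑ˡ b) ≡ δ (f i) v * x (i ↑ˡ b)
  same i rewrite ⊎ᶠ-↑ˡ f g i = cong (_* x (i ↑ˡ b)) (δ-injective (↑ˡ-injective d _ _) (f i) v)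
  disjoint : ∀ j → δ ((f ⊎ᶠ g) (a ↑ʳ j)) (v ↑ˡ d) * x (a ↑ʳ j) ≡ 0
  disjoint j rewrite ⊎ᶠ-↑ʳ f g j = cong (_* x (a ↑ʳ j)) (δ-≢ (↑ˡ≢↑ʳ v (g j) ∘ sym))

incidentSum-↑ʳ : ∀ {a b c d} (f : Fin a → Fin c) (g : Fin b → Fin d) v (x : Fin (a + b) → ℕ) →
  incidentSum (f ⊎ᶠ g) (c ↑ʳ v) x ≡ incidentSum g v (x ∘ (a ↑ʳ_))
incidentSum-↑ʳ {a} {b} {c} {d} f g v x =
  trans (∑-↑ a b _) (cong₂ _+_ (trans (sum-cong-≗ disjoint) (sum-replicate-zero a)) (sum-cong-≗ same))
  where
  disjoint : ∀ i → δ ((f ⊎ᶠ g) (i ↑ˡ b)) (c ↑ʳ v) * x (i ↑ˡ b) ≡ 0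
  disjoint i rewrite ⊎ᶠ-↑ˡ f g i = cong (_* x (i ↑ˡ b)) (δ-≢ (↑ˡ≢↑ʳ (f i) v))
  same : ∀ j → δ ((f ⊎ᶠ g) (a ↑ʳ j)) (c ↑ʳ v) * x (a ↑ʳ j) ≡ δ (g j) v * x (a ↑ʳ j)
  same j rewrite ⊎ᶠ-↑ʳ f g j = cong (_* x (a ↑ʳ j)) (δ-injective (↑ʳ-injective c _ _) (g j) v)

_⊕_ : Digraph → Digraph → Digraph
G ⊕ H = record { V = V G + V H ; E = E G + E H ; src = src G ⊎ᶠ src H ; tgt = tgt G ⊎ᶠ tgt H }

Balanced-⊕ : ∀ G H k (x : Fin (E (G ⊕ H)) → ℕ) →
  Balanced (G ⊕ H) k x ⇔ (Balanced G k (x ∘ (_↑ˡ E H)) × Balanced H k (x ∘ (E G ↑ʳ_)))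
Balanced-⊕ G H k x = mk⇔
  (λ bal → (λ v → subst₂ _≡mod_ (incidentSum-↑ˡ (src G) (src H) v x) (incidentSum-↑ˡ (tgt G) (tgt H) v x) (bal (v ↑ˡ V H)))
         , (λ v → subst₂ _≡mod_ (incidentSum-↑ʳ (src G) (src H) v x) (incidentSum-↑ʳ (tgt G) (tgt H) v x) (bal (V G ↑ʳ v))))
  (λ (balG , balH) → ↑-elim _
    (λ v → subst₂ _≡mod_ (sym (incidentSum-↑ˡ (src G) (src H) v x)) (sym (incidentSum-↑ˡ (tgt G) (tgt H) v x)) (balG v))
    (λ v → subst₂ _≡mod_ (sym (incidentSum-↑ʳ (src G) (src H) v x)) (sym (incidentSum-↑ʳ (tgt G) (tgt H) v x)) (balH v)))
  where
  _≡mod_ : ℕ → ℕ → Set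
  a ≡mod b = a % suc k ≡ b % suc k

bundle : ℕ → Digraph
bundle M = record { V = 2 ; E = M ; src = λ _ → zero ; tgt = λ _ → suc zero }

Balanced-bundle : ∀ M k (x : Fin M → ℕ) → Balanced (bundle M) k x ⇔ suc k ∣ ∑[ e < M ] x e
Balanced-bundle M k x = mk⇔
  (λ bal → m%n≡0⇒n∣m _ (suc k) (trans (cong (_% suc k) (sym out)) (trans (bal zero) (cong (_% suc k) (sum-replicate-zero M)))))
  (λ n∣∑ → λ
    { zero → trans (cong (_% suc k) out) (trans (n∣m⇒m%n≡0 _ (suc k) n∣∑) (cong (_% suc k) (sym (sum-replicate-zero M))))
    ; (suc zero) → trans (cong (_% suc k) (sum-replicate-zero M)) (trans (sym (n∣m⇒m%n≡0 _ (suc k) n∣∑)) (cong (_% suc k) (sym out))) })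
  where
  out : ∑[ e < M ] (1 * x e) ≡ ∑[ e < M ] x e
  out = sum-cong-≗ λ e → *-identityˡ (x e)

dipole : ℕ → Digraph
dipole d = record
  { V = 2 ; E = suc (suc d)
  ; src = λ { zero → suc zero ; (suc _) → zero }
  ; tgt = λ { zero → zero ; (suc _) → suc zero } }

Balanced-dipole : ∀ d k (x : Fin (suc (suc d)) → ℕ) → Balanced (dipole d) k x →
  ∑[ j < suc d ] x (suc j) % suc k ≡ x zero % suc k
Balanced-dipole d k x bal = begin
  ∑[ j < suc d ] x (suc j) % suc k         ≡⟨ cong (_% suc k) (sum-cong-≗ λ j → *-identityˡ (x (suc j))) ⟨
  ∑[ j < suc d ] (1 * x (suc j)) % suc k   ≡⟨ bal zero ⟩
  (1 * x zero + ∑[ j < suc d ] 0) % suc k  ≡⟨ cong (_% suc k) (cong₂ _+_ (*-identityˡ (x zero)) (sum-replicate-zero (suc d))) ⟩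
  (x zero + 0) % suc k                     ≡⟨ cong (_% suc k) (+-identityʳ (x zero)) ⟩
  x zero % suc k                           ∎
  where open ≡-Reasoning

Balanced-digon : ∀ G k {e₁ e₂} → src G e₁ ≡ tgt G e₂ → tgt G e₁ ≡ src G e₂ →
  Balanced G k (λ e → δ e₁ e + δ e₂ e)
Balanced-digon G k {e₁} {e₂} s₁≡t₂ t₁≡s₂ v = cong (_% suc k) (begin
  incidentSum (src G) v (λ e → δ e₁ e + δ e₂ e)   ≡⟨ incidentSum-δ+δ (src G) v e₁ e₂ ⟩
  δ (src G e₁) v + δ (src G e₂) v                 ≡⟨ cong₂ (λ a b → δ a v + δ b v) s₁≡t₂ (sym t₁≡s₂) ⟩
  δ (tgt G e₂) v + δ (tgt G e₁) v                 ≡⟨ +-comm (δ (tgt G e₂) v) _ ⟩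
  δ (tgt G e₁) v + δ (tgt G e₂) v                 ≡⟨ incidentSum-δ+δ (tgt G) v e₁ e₂ ⟨
  incidentSum (tgt G) v (λ e → δ e₁ e + δ e₂ e)   ∎)
  where open ≡-Reasoning

dipoles : List ℕ → Digraph
dipoles [] = record { V = 0 ; E = 0 ; src = λ () ; tgt = λ () }
dipoles (d ∷ ds) = dipole d ⊕ dipoles ds

component : ∀ {d ds} → d ∈ ds → Fin (E (dipole d)) → Fin (E (dipoles ds))
component {ds = d ∷ ds} (here refl) e = e ↑ˡ E (dipoles ds)
component {ds = d′ ∷ ds} (there p) e = E (dipole d′) ↑ʳ component p e

componentV : ∀ {d ds} → d ∈ ds → Fin 2 → Fin (V (dipoles ds))
componentV {ds = d ∷ ds} (here refl) v = v ↑ˡ V (dipoles ds)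
componentV {ds = d′ ∷ ds} (there p) v = 2 ↑ʳ componentV p v

src-component : ∀ {d ds} (p : d ∈ ds) e → src (dipoles ds) (component p e) ≡ componentV p (src (dipole d) e)
src-component {ds = d ∷ ds} (here refl) e = ⊎ᶠ-↑ˡ (src (dipole d)) (src (dipoles ds)) e
src-component {ds = d′ ∷ ds} (there p) e =
  trans (⊎ᶠ-↑ʳ (src (dipole d′)) (src (dipoles ds)) (component p e)) (cong (2 ↑ʳ_) (src-component p e))

tgt-component : ∀ {d ds} (p : d ∈ ds) e → tgt (dipoles ds) (component p e) ≡ componentV p (tgt (dipole d) e)
tgt-component {ds = d ∷ ds} (here refl) e = ⊎ᶠ-↑ˡ (tgt (dipole d)) (tgt (dipoles ds)) e
tgt-component {ds = d′ ∷ ds} (there p) e =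
  trans (⊎ᶠ-↑ʳ (tgt (dipole d′)) (tgt (dipoles ds)) (component p e)) (cong (2 ↑ʳ_) (tgt-component p e))

component-injective : ∀ {d ds} (p : d ∈ ds) → Injective _≡_ _≡_ (component p)
component-injective {ds = d ∷ ds} (here refl) = ↑ˡ-injective _ _ _
component-injective {ds = d′ ∷ ds} (there p) = component-injective p ∘ ↑ʳ-injective _ _ _

Balanced-component : ∀ {d ds} k (x : Fin (E (dipoles ds)) → ℕ) → Balanced (dipoles ds) k x →
  (p : d ∈ ds) → Balanced (dipole d) k (x ∘ component p)
Balanced-component {ds = d ∷ ds} k x bal (here refl) = proj₁ (Equivalence.to (Balanced-⊕ (dipole d) (dipoles ds) k x) bal)
Balanced-component {ds = d′ ∷ ds} k x bal (there p) =
  Balanced-component k (x ∘ (E (dipole d′) ↑ʳ_)) (proj₂ (Equivalence.to (Balanced-⊕ (dipole d′) (dipoles ds) k x) bal)) p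

dipoles-edge⇒∈ : ∀ ds → Fin (E (dipoles ds)) → ∃[ d ] d ∈ ds
dipoles-edge⇒∈ (d ∷ ds) _ = d , here refl

FlowContinuous⇒balanced : ∀ {G H k f} → FlowContinuous G H k f →
  (x : Fin (E H) → ℕ) → (∀ e → x e < suc k) → Balanced H k x → Balanced G k (x ∘ f)
FlowContinuous⇒balanced {G} {H} {k} {f} cont x x<n bal =
  Balanced-cong G k (λ e → toℕ-fromℕ< (x<n (f e)))
    (Equivalence.to (IsFlow⇔Balanced G k (φ ∘ f))
      (cont φ (Equivalence.from (IsFlow⇔Balanced H k φ) (Balanced-cong H k (λ e → sym (toℕ-fromℕ< (x<n e))) bal))))
  where
  φ : Fin (E H) → Zmod k
  φ e = fromℕ< (x<n e)

-- The modulus suc (q + k * suc q) is suc k * suc q.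
Balanced-*ʳ : ∀ G k q (x : Fin (E G) → ℕ) →
  Balanced G (q + k * suc q) (λ e → x e * suc q) ⇔ Balanced G k x
Balanced-*ʳ G k q x = mk⇔
  (λ bal v → *-cancelʳ-≡ _ _ (suc q) (trans (scaled (src G) v) (trans (bal v) (sym (scaled (tgt G) v)))))
  (λ bal v → trans (sym (scaled (src G) v)) (trans (cong (_* suc q) (bal v)) (scaled (tgt G) v)))
  where
  scaled : ∀ (s : Fin (E G) → Fin (V G)) v →
    incidentSum s v x % suc k * suc q ≡ incidentSum s v (λ e → x e * suc q) % (suc k * suc q)
  scaled s v = trans (m%n*o≡m*o%[n*o] (incidentSum s v x) (suc k) (suc q))
                     (cong (_% (suc k * suc q)) (sym (incidentSum-*ʳ s v x (suc q))))

FlowContinuous-∣ : ∀ {G H} k q {f} → FlowContinuous G H (q + k * suc q) f → FlowContinuous G H k f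
FlowContinuous-∣ {G} {H} k q {f} cont φ flow =
  Equivalence.from (IsFlow⇔Balanced G k (φ ∘ f)) (Equivalence.to (Balanced-*ʳ G k q (toℕ ∘ φ ∘ f))
    (FlowContinuous⇒balanced {G} {H} cont (λ e → toℕ (φ e) * suc q) (λ e → *-monoˡ-< (suc q) (toℕ<n (φ e)))
      (Equivalence.from (Balanced-*ʳ H k q (toℕ ∘ φ)) (Equivalence.to (IsFlow⇔Balanced H k φ) flow))))

InFF-∣ : ∀ {G H d n} → 1 ≤ d → d ∣ n → InFF G H n → InFF G H d
InFF-∣ {G} {H} {suc k} _ (divides (suc q) n≡[1+q][1+k]) (inFF _ f cont) =
  inFF k f (FlowContinuous-∣ {G} {H} k q (subst (λ K → FlowContinuous G H K f) K≡ cont))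
  where K≡ = suc-injective (trans n≡[1+q][1+k] (*-comm (suc q) (suc k)))

bundles-FlowContinuous : ∀ {m m′} H k (f : Fin (m + m′) → Fin (E H)) →
  FlowContinuous (bundle m ⊕ bundle m′) H k f ⇔
  (∀ x → (∀ e → x e < suc k) → Balanced H k x →
     suc k ∣ ∑[ i < m ] x (f (i ↑ˡ m′)) × suc k ∣ ∑[ j < m′ ] x (f (m ↑ʳ j)))
bundles-FlowContinuous {m} {m′} H k f = mk⇔
  (λ cont x x<n bal → sums-divisible (FlowContinuous⇒balanced {G} {H} cont x x<n bal))
  (λ sums φ flow → Equivalence.from (IsFlow⇔Balanced G k (φ ∘ f))
    (sums⇒balanced (sums (toℕ ∘ φ) (toℕ<n ∘ φ) (Equivalence.to (IsFlow⇔Balanced H k φ) flow))))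
  where
  G : Digraph
  G = bundle m ⊕ bundle m′
  sums-divisible : ∀ {y} → Balanced G k y → suc k ∣ ∑[ i < m ] y (i ↑ˡ m′) × suc k ∣ ∑[ j < m′ ] y (m ↑ʳ j)
  sums-divisible bal with Equivalence.to (Balanced-⊕ (bundle m) (bundle m′) k _) bal
  ... | bal₁ , bal₂ = Equivalence.to (Balanced-bundle m k _) bal₁ , Equivalence.to (Balanced-bundle m′ k _) bal₂
  sums⇒balanced : ∀ {y} → suc k ∣ ∑[ i < m ] y (i ↑ˡ m′) × suc k ∣ ∑[ j < m′ ] y (m ↑ʳ j) → Balanced G k y
  sums⇒balanced (n∣∑₁ , n∣∑₂) = Equivalence.from (Balanced-⊕ (bundle m) (bundle m′) k _)
    (Equivalence.from (Balanced-bundle m k _) n∣∑₁ , Equivalence.from (Balanced-bundle m′ k _) n∣∑₂)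

%-≡⇒∣+ : ∀ n .{{_ : NonZero n}} {a b c} → a % n ≡ b % n → n ∣ b + c → n ∣ a + c
%-≡⇒∣+ n {a} {b} {c} a≡b n∣b+c = m%n≡0⇒n∣m (a + c) n (begin
  (a + c) % n           ≡⟨ %-distribˡ-+ a c n ⟩
  (a % n + c % n) % n   ≡⟨ cong (λ z → (z + c % n) % n) a≡b ⟩
  (b % n + c % n) % n   ≡⟨ %-distribˡ-+ b c n ⟨
  (b + c) % n           ≡⟨ n∣m⇒m%n≡0 (b + c) n n∣b+c ⟩
  0                     ∎)
  where open ≡-Reasoning

-- The d + 1 forward edges once each, then the back edge r times.
fold : ∀ {M d r} → M ≡ suc d + r → Fin M → Fin (E (dipole d))
fold {d = d} refl = Sum.[ suc , (λ _ → zero) ] ∘ splitAt (suc d)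

∑-fold : ∀ {M d r} (M≡ : M ≡ suc d + r) (x : Fin (E (dipole d)) → ℕ) →
  ∑[ g < M ] x (fold M≡ g) ≡ ∑[ j < suc d ] x (suc j) + r * x zero
∑-fold {d = d} {r} refl x = begin
  ∑[ g < suc d + r ] x (fold refl g)
    ≡⟨ ∑-↑ (suc d) r (x ∘ fold refl) ⟩
  ∑[ i < suc d ] x (fold refl (i ↑ˡ r)) + ∑[ j < r ] x (fold refl (suc d ↑ʳ j))
    ≡⟨ cong₂ _+_ (sum-cong-≗ λ i → cong (x ∘ Sum.[ suc , (λ _ → zero) ]) (splitAt-↑ˡ (suc d) i r))
                 (sum-cong-≗ λ j → cong (x ∘ Sum.[ suc , (λ _ → zero) ]) (splitAt-↑ʳ (suc d) r j)) ⟩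
  ∑[ i < suc d ] x (suc i) + ∑[ j < r ] x zero
    ≡⟨ cong (∑[ i < suc d ] x (suc i) +_) (∑-const r (x zero)) ⟩
  ∑[ j < suc d ] x (suc j) + r * x zero
    ∎
  where open ≡-Reasoning

-- The pulled-back sum is congruent to (1 + r) · (back-edge value).
fold-divisible : ∀ {M d r} k (M≡ : M ≡ suc d + r) → suc k ∣ suc r →
  (x : Fin (E (dipole d)) → ℕ) → Balanced (dipole d) k x → suc k ∣ ∑[ g < M ] x (fold M≡ g)
fold-divisible {d = d} {r} k M≡ n∣1+r x bal = subst (suc k ∣_) (sym (∑-fold M≡ x))
  (%-≡⇒∣+ (suc k) {c = r * x zero} (Balanced-dipole d k x bal) (∣m⇒∣m*n (x zero) n∣1+r))

∣m+n∣n⇒∣m : ∀ {d m n} → d ∣ m + n → d ∣ n → d ∣ m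
∣m+n∣n⇒∣m {d} {m} {n} d∣m+n d∣n = ∣m+n∣m⇒∣n (subst (d ∣_) (+-comm m n) d∣m+n) d∣n

<2*∧<2*⇒<+ : ∀ {M a b} → M < 2 * a → M < 2 * b → M < a + b
<2*∧<2*⇒<+ {M} {a} {b} M<2a M<2b with ≤-total a b
... | inj₁ a≤b = <-≤-trans M<2a (subst (_≤ a + b) (cong (a +_) (sym (+-identityʳ a))) (+-monoʳ-≤ a a≤b))
... | inj₂ b≤a = <-≤-trans M<2b (subst (_≤ a + b) (cong (b +_) (sym (+-identityʳ b))) (+-monoˡ-≤ b b≤a))

data Shape (n M : ℕ) (ds : List ℕ) (S : ℕ) : Set where
  divisible : n ∣ S → Shape n M ds S
  shifted   : ∀ {d q} → d ∈ ds → S ≡ d + q → n ∣ q → Shape n M ds S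
  exceeds   : M < S → Shape n M ds S

-- With c j ≡ −b (mod n): either n ∣ b; or b ≡ −1, so every c j ≡ 1 and the total is
-- d plus a multiple of n; or every c j is at least 2.
dipole-shape : ∀ {n M d} → M < 2 * d → (b : ℕ) (c : Fin (suc d) → ℕ) → (∀ j → n ∣ c j + b) →
  Shape n M (d ∷ []) (b + ∑[ j < suc d ] c j)
dipole-shape {n} {M} {d} M<2d b c n∣c+b with n ∣? b | n ∣? suc b
... | yes n∣b | _ = divisible (∣m∣n⇒∣m+n n∣b (∑-∣ (suc d) c λ j → ∣m+n∣n⇒∣m (n∣c+b j) n∣b))
... | no n∤b | yes n∣1+b = shifted (here refl) τ≡d+q (∣m∣n⇒∣m+n n∣1+b (∑-∣ (suc d) e n∣e))
  where
  e : Fin (suc d) → ℕ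
  e j = pred (c j)
  c≡1+e : ∀ j → c j ≡ suc (e j)
  c≡1+e j = sym (suc-pred (c j) {{≢-nonZero λ c≡0 → n∤b (subst (λ z → n ∣ z + b) c≡0 (n∣c+b j))}})
  n∣e : ∀ j → n ∣ e j
  n∣e j = ∣m+n∣n⇒∣m (subst (n ∣_) (trans (cong (_+ b) (c≡1+e j)) (sym (+-suc (e j) b))) (n∣c+b j)) n∣1+b
  τ≡d+q : b + ∑[ j < suc d ] c j ≡ d + (suc b + ∑[ j < suc d ] e j)
  τ≡d+q = begin
    b + ∑[ j < suc d ] c j                       ≡⟨ cong (b +_) (sum-cong-≗ c≡1+e) ⟩
    b + ∑[ j < suc d ] (1 + e j)                 ≡⟨ cong (b +_) (∑-distrib-+ (λ _ → 1) e) ⟩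
    b + (∑[ j < suc d ] 1 + ∑[ j < suc d ] e j)  ≡⟨ cong (λ z → b + (z + ∑[ j < suc d ] e j)) (trans (∑-const (suc d) 1) (*-identityʳ (suc d))) ⟩
    b + (suc d + ∑[ j < suc d ] e j)             ≡⟨ rearrange b d (∑[ j < suc d ] e j) ⟩
    d + (suc b + ∑[ j < suc d ] e j)             ∎
    where
    open ≡-Reasoning
    rearrange : ∀ b d s → b + (suc d + s) ≡ d + (suc b + s)
    rearrange = solve-∀
... | no n∤b | no n∤1+b = exceeds (<-≤-trans M<2d (≤-trans 2d≤∑c (m≤n+m _ b)))
  where
  2≤c : ∀ j → 2 ≤ c j
  2≤c j with c j | n∣c+b j
  ... | 0 | n∣b = contradiction n∣b n∤b
  ... | 1 | n∣1+b = contradiction n∣1+b n∤1+b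
  ... | suc (suc _) | _ = s≤s (s≤s z≤n)
  2d≤∑c : 2 * d ≤ ∑[ j < suc d ] c j
  2d≤∑c = begin
    2 * d                  ≤⟨ *-monoʳ-≤ 2 (n≤1+n d) ⟩
    2 * suc d              ≡⟨ trans (*-comm 2 (suc d)) (sym (∑-const (suc d) 2)) ⟩
    ∑[ j < suc d ] 2       ≤⟨ ∑-mono-≤ (suc d) 2≤c ⟩
    ∑[ j < suc d ] c j     ∎
    where open ≤-Reasoning

-- Two shifted components cannot both occur: their totals would exceed M < d + d′.
Shape-∷ : ∀ {n M d ds τ S} → (∀ {d′} → d′ ∈ d ∷ ds → M < 2 * d′) →
  Shape n M (d ∷ []) τ → Shape n M ds S → Shape n M (d ∷ ds) (τ + S)
Shape-∷ bound (divisible n∣τ) (divisible n∣S) = divisible (∣m∣n⇒∣m+n n∣τ n∣S)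
Shape-∷ {τ = τ} bound (divisible n∣τ) (shifted {d′} {q} p S≡d′+q n∣q) =
  shifted (there p) (trans (cong (τ +_) S≡d′+q) (+-comm-middle τ d′ q)) (∣m∣n⇒∣m+n n∣τ n∣q)
  where
  +-comm-middle : ∀ a b c → a + (b + c) ≡ b + (a + c)
  +-comm-middle = solve-∀
Shape-∷ {τ = τ} bound (divisible _) (exceeds M<S) = exceeds (<-≤-trans M<S (m≤n+m _ τ))
Shape-∷ {d = d} {S = S} bound (shifted (here refl) τ≡d+q n∣q) (divisible n∣S) =
  shifted (here refl) (trans (cong (_+ S) τ≡d+q) (+-assoc d _ S)) (∣m∣n⇒∣m+n n∣q n∣S)
Shape-∷ {d = d} bound (shifted {q = q} (here refl) τ≡d+q _) (shifted {d′} {q′} p S≡d′+q′ _) =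
  exceeds (<-≤-trans (<2*∧<2*⇒<+ {a = d} {d′} (bound (here refl)) (bound (there p)))
    (subst (d + d′ ≤_) (sym (cong₂ _+_ τ≡d+q S≡d′+q′)) (+-mono-≤ (m≤m+n d q) (m≤m+n d′ q′))))
Shape-∷ {τ = τ} bound (shifted _ _ _) (exceeds M<S) = exceeds (<-≤-trans M<S (m≤n+m _ τ))
Shape-∷ {S = S} bound (exceeds M<τ) _ = exceeds (<-≤-trans M<τ (m≤m+n _ S))

dipoles-shape : ∀ {n M} ds (c : Fin (E (dipoles ds)) → ℕ) →
  (∀ {d} (p : d ∈ ds) j → n ∣ c (component p (suc j)) + c (component p zero)) →
  (∀ {d} → d ∈ ds → M < 2 * d) → Shape n M ds (∑[ e < E (dipoles ds) ] c e)
dipoles-shape [] c _ _ = divisible (_ ∣0)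
dipoles-shape (d ∷ ds) c n∣c bound =
  subst (Shape _ _ (d ∷ ds)) (sym (∑-↑ (E (dipole d)) (E (dipoles ds)) c))
    (Shape-∷ bound (dipole-shape (bound (here refl)) (c (zero ↑ˡ E (dipoles ds))) (λ j → c (suc j ↑ˡ E (dipoles ds))) (n∣c (here refl)))
      (dipoles-shape ds (c ∘ (E (dipole d) ↑ʳ_)) (n∣c ∘ there) (bound ∘ there)))

digon-preimages : ∀ {M ds} k (F : Fin M → Fin (E (dipoles ds))) →
  (∀ x → (∀ e → x e < suc k) → Balanced (dipoles ds) k x → suc k ∣ ∑[ g < M ] x (F g)) →
  ∀ {d} (p : d ∈ ds) j → suc k ∣ preimages F (component p (suc j)) + preimages F (component p zero)
digon-preimages zero F _ p j = 1∣ _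
digon-preimages {M} {ds} (suc k) F n∣∑ p j = subst (suc (suc k) ∣_) ∑≡preimages
  (n∣∑ (λ e → δ e₁ e + δ e₂ e) (λ e → s≤s (≤-trans (δ+δ≤1 e₁≢e₂ e) (s≤s z≤n)))
       (Balanced-digon (dipoles ds) (suc k) (trans (src-component p (suc j)) (sym (tgt-component p zero)))
                                            (trans (tgt-component p (suc j)) (sym (src-component p zero)))))
  where
  e₁ e₂ : Fin (E (dipoles ds))
  e₁ = component p (suc j)
  e₂ = component p zero
  e₁≢e₂ : e₁ ≢ e₂
  e₁≢e₂ e₁≡e₂ with component-injective p e₁≡e₂
  ... | ()
  ∑≡preimages : ∑[ g < M ] (δ e₁ (F g) + δ e₂ (F g)) ≡ preimages F e₁ + preimages F e₂
  ∑≡preimages = trans (∑-distrib-+ (δ e₁ ∘ F) (δ e₂ ∘ F))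
                      (cong₂ _+_ (sum-cong-≗ λ g → δ-sym e₁ (F g)) (sum-cong-≗ λ g → δ-sym e₂ (F g)))

bundleMap-shape : ∀ {M ds} k (F : Fin M → Fin (E (dipoles ds))) →
  (∀ x → (∀ e → x e < suc k) → Balanced (dipoles ds) k x → suc k ∣ ∑[ g < M ] x (F g)) →
  (∀ {d} → d ∈ ds → M < 2 * d) →
  suc k ∣ M ⊎ ∃[ d ] ∃[ q ] (d ∈ ds × M ≡ d + q × suc k ∣ q)
bundleMap-shape {M} {ds} k F n∣∑ bound
  with subst (Shape (suc k) M ds) (∑-preimages F) (dipoles-shape ds (preimages F) (digon-preimages k F n∣∑) bound)
... | divisible n∣M = inj₁ n∣M
... | shifted p M≡d+q n∣q = inj₂ (_ , _ , p , M≡d+q , n∣q)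
... | exceeds M<M = contradiction M<M (<-irrefl refl)

≤⇒∣! : ∀ {a b} → 1 ≤ a → a ≤ b → a ∣ b !
≤⇒∣! {suc a} _ a<b = ∣-trans (m∣m*n (a !)) (m≤n⇒m!∣n! a<b)

∣suc-!⇒≡1 : ∀ {n a} → n ∣ suc (a !) → n ≤ a → n ≡ 1
∣suc-!⇒≡1 {zero} 0∣ _ with () ← 0∣⇒≡0 0∣
∣suc-!⇒≡1 {suc n} {a} n∣ n≤a = ∣1⇒≡1 (∣m+n∣n⇒∣m {m = 1} {a !} n∣ (≤⇒∣! (s≤s z≤n) n≤a))

n≤n! : ∀ n → n ≤ n !
n≤n! zero = z≤n
n≤n! (suc n) = ∣⇒≤ {{suc n !≢0}} (m∣m*n (n !))

module Construction (T : List ℕ) (T≥1 : All (1 ≤_) T) where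

  L : ℕ
  L = product T

  instance
    L≢0 : NonZero L
    L≢0 = product≢0 (All.map >-nonZero T≥1)

  m : ℕ
  m = suc ((3 * L) !)

  ds : List ℕ
  ds = map (m ∸_) T

  G H : Digraph
  G = bundle m ⊕ bundle (m + L)
  H = dipoles ds

  t≤L : ∀ {t} → t ∈ T → t ≤ L
  t≤L t∈T = ∣⇒≤ (∈⇒∣product t∈T)

  t≤m : ∀ {t} → t ∈ T → t ≤ m
  t≤m t∈T = ≤-trans (t≤L t∈T) (≤-trans (m≤m+n L _) (≤-trans (n≤n! (3 * L)) (n≤1+n _)))

  m+L<2[m∸t] : ∀ {t} → t ∈ T → m + L < 2 * (m ∸ t)
  m+L<2[m∸t] {t} t∈T = begin-strict
    m + L                ≡⟨ cong (_+ L) (sym (m∸n+n≡m (t≤m t∈T))) ⟩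
    (m ∸ t) + t + L      ≡⟨ +-assoc (m ∸ t) t L ⟩
    (m ∸ t) + (t + L)    <⟨ +-monoʳ-< (m ∸ t) t+L<m∸t ⟩
    (m ∸ t) + (m ∸ t)    ≡⟨ cong ((m ∸ t) +_) (+-identityʳ (m ∸ t)) ⟨
    2 * (m ∸ t)          ∎
    where
    open ≤-Reasoning
    threefold : ∀ a → a + a + a ≡ 3 * a
    threefold = solve-∀
    t+L<m∸t : t + L < m ∸ t
    t+L<m∸t = +-cancelʳ-< t (t + L) (m ∸ t) (begin-strict
      t + L + t            ≤⟨ +-mono-≤ (+-monoˡ-≤ L (t≤L t∈T)) (t≤L t∈T) ⟩
      L + L + L            ≡⟨ threefold L ⟩
      3 * L                <⟨ s≤s (n≤n! (3 * L)) ⟩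
      m                    ≡⟨ m∸n+n≡m (t≤m t∈T) ⟨
      (m ∸ t) + t          ∎)

  bounded : ∀ {M} → M ≤ m + L → ∀ {d} → d ∈ ds → M < 2 * d
  bounded M≤m+L d∈ds with ∈-map⁻ (m ∸_) d∈ds
  ... | t , t∈T , refl = ≤-<-trans M≤m+L (m+L<2[m∸t] t∈T)

  unshift : ∀ {M d q} → d ∈ ds → M ≡ d + q → ∃[ t ] (t ∈ T × M + t ≡ m + q)
  unshift {M} {q = q} d∈ds M≡d+q with ∈-map⁻ (m ∸_) d∈ds
  ... | t , t∈T , refl = t , t∈T , (begin
    M + t               ≡⟨ cong (_+ t) M≡d+q ⟩
    (m ∸ t) + q + t     ≡⟨ swap (m ∸ t) q t ⟩
    (m ∸ t) + t + q     ≡⟨ cong (_+ q) (m∸n+n≡m (t≤m t∈T)) ⟩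
    m + q               ∎)
    where
    open ≡-Reasoning
    swap : ∀ a b c → a + b + c ≡ a + c + b
    swap = solve-∀

  divisor⇒InFF : ∀ {k t} → t ∈ T → suc k ∣ t → InFF G H (suc k)
  divisor⇒InFF {t = zero} t∈T _ with () ← All.lookup T≥1 t∈T
  divisor⇒InFF {k} {suc r} t∈T n∣t = inFF k (F₁ ++ F₂) (Equivalence.from (bundles-FlowContinuous H k (F₁ ++ F₂)) λ x _ bal →
      subst (suc k ∣_) (sum-cong-≗ λ i → cong x (sym (lookup-++ˡ F₁ F₂ i)))
        (fold-divisible k m≡ n∣t (x ∘ component d∈ds) (Balanced-component k x bal d∈ds))
    , subst (suc k ∣_) (sum-cong-≗ λ j → cong x (sym (lookup-++ʳ F₁ F₂ j)))
        (fold-divisible k m+L≡ n∣t+L (x ∘ component d∈ds) (Balanced-component k x bal d∈ds)))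
    where
    d : ℕ
    d = m ∸ suc r
    d∈ds : d ∈ ds
    d∈ds = ∈-map⁺ (m ∸_) t∈T
    m≡ : m ≡ suc d + r
    m≡ = trans (sym (m∸n+n≡m (t≤m t∈T))) (+-suc d r)
    m+L≡ : m + L ≡ suc d + (r + L)
    m+L≡ = trans (cong (_+ L) m≡) (+-assoc (suc d) r L)
    n∣t+L : suc k ∣ suc (r + L)
    n∣t+L = ∣m∣n⇒∣m+n n∣t (∣-trans n∣t (∈⇒∣product t∈T))
    F₁ : Fin m → Fin (E H)
    F₁ = component d∈ds ∘ fold m≡
    F₂ : Fin (m + L) → Fin (E H)
    F₂ = component d∈ds ∘ fold m+L≡

  InFF⇒divisor : ∀ {n} → InFF G H n → ∃[ t ] (t ∈ T × n ∣ t)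
  InFF⇒divisor (inFF k f cont) =
    decide (bundleMap-shape k (f ∘ (_↑ˡ (m + L))) (λ x x<n bal → proj₁ (sums x x<n bal)) (bounded (m≤m+n m L)))
           (bundleMap-shape k (f ∘ (m ↑ʳ_)) (λ x x<n bal → proj₂ (sums x x<n bal)) (bounded ≤-refl))
    where
    n : ℕ
    n = suc k
    sums = Equivalence.to (bundles-FlowContinuous H k f) cont
    unit : n ∣ m → n ≤ 3 * L → ∃[ t ] (t ∈ T × n ∣ t)
    unit n∣m n≤3L with dipoles-edge⇒∈ ds (f zero)
    ... | _ , d∈ds with ∈-map⁻ (m ∸_) d∈ds
    ... | t , t∈T , _ = t , t∈T , subst (_∣ t) (sym (∣suc-!⇒≡1 n∣m n≤3L)) (1∣ t)
    decide : n ∣ m ⊎ ∃[ d ] ∃[ q ] (d ∈ ds × m ≡ d + q × n ∣ q) →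
             n ∣ m + L ⊎ ∃[ d ] ∃[ q ] (d ∈ ds × m + L ≡ d + q × n ∣ q) → ∃[ t ] (t ∈ T × n ∣ t)
    decide (inj₂ (_ , q , d∈ds , m≡d+q , n∣q)) _ with unshift d∈ds m≡d+q
    ... | t , t∈T , m+t≡m+q = t , t∈T , subst (n ∣_) (sym (+-cancelˡ-≡ m t q m+t≡m+q)) n∣q
    decide (inj₁ n∣m) (inj₁ n∣m+L) = unit n∣m (≤-trans (∣⇒≤ (∣m+n∣m⇒∣n n∣m+L n∣m)) (m≤m+n L _))
    decide (inj₁ n∣m) (inj₂ (_ , q , d∈ds , m+L≡d+q , n∣q)) with unshift d∈ds m+L≡d+q
    ... | t , t∈T , m+L+t≡m+q = unit n∣m (≤-trans (∣⇒≤ {{>-nonZero (≤-trans (>-nonZero⁻¹ L) (m≤m+n L t))}} n∣L+t)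
                                                   (+-monoʳ-≤ L (≤-trans (t≤L t∈T) (m≤m+n L _))))
      where
      n∣L+t : n ∣ L + t
      n∣L+t = subst (n ∣_) (sym (+-cancelˡ-≡ m (L + t) q (trans (sym (+-assoc m L t)) m+L+t≡m+q))) n∣q

  InFF⇔divisor : ∀ n → InFF G H n ⇔ (1 ≤ n × ∃[ t ] (t ∈ T × n ∣ t))
  InFF⇔divisor zero = mk⇔ (λ ()) (λ ())
  InFF⇔divisor (suc k) = mk⇔ (λ ff → s≤s z≤n , InFF⇒divisor ff) (λ (_ , _ , t∈T , n∣t) → divisor⇒InFF t∈T n∣t)

theorem2p9 : (S : List ℕ) → All (1 ≤_) S →
    (∃[ G ] ∃[ H ] (∀ n → (n ∈ S) ⇔ InFF G H n))
      ⇔ (∃[ T ] (All (1 ≤_) T × (∀ s → (s ∈ S) ⇔ (1 ≤ s × ∃[ t ] (t ∈ T × s ∣ t)))))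
theorem2p9 S S≥1 = mk⇔
  (λ (G , H , S⇔FF) → S , S≥1 , λ s → mk⇔
    (λ s∈S → All.lookup S≥1 s∈S , s , s∈S , ∣-refl)
    (λ (1≤s , t , t∈S , s∣t) → Equivalence.from (S⇔FF s) (InFF-∣ 1≤s s∣t (Equivalence.to (S⇔FF t) t∈S))))
  (λ (T , T≥1 , S⇔divisor) → Construction.G T T≥1 , Construction.H T T≥1 ,
    λ n → ⇔-trans (S⇔divisor n) (⇔-sym (Construction.InFF⇔divisor T T≥1 n)))
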